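{- Let $m>1$ and $n>0$ be integers. Then the largest clique in ${\rm SR}(m,n)$ has size $\max(m,n+1)$.
   Context: Let $\mathbb{N}$ denote the nonnegative integers. For $m,n\in\mathbb{N}$, the simplicial rook graph ${\rm SR}(m,n)$ has as vertices the vectors in $\mathbb{N}^m$ with coordinate sum $n$, two vertices being adjacent when they differ in precisely two coordinate positions. -}

module Defs where

open import Data.Nat using (ℕ; zero; suc; _+_; _⊔_; _≤_)
open import Data.Vec using (Vec; []; _∷_; sum)
open import Data.List using (List; length)
open import Data.List.Relation.Unary.All using (All)
open import Data.List.Relation.Unary.AllPairs using (AllPairs)
open import Relation.Binary.PropositionalEquality using (_≡_)
open import Relation.Nullary using (Dec; yes; no)
open import Data.Nat using (_≟_)
open import Data.Product using (_×_; ∃)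

diffCount : {m : ℕ} → Vec ℕ m → Vec ℕ m → ℕ
diffCount [] [] = 0
diffCount (x ∷ xs) (y ∷ ys) with x ≟ y
... | yes _ = diffCount xs ys
... | no _ = suc (diffCount xs ys)

IsVertex : (m n : ℕ) → Vec ℕ m → Set
IsVertex m n v = sum v ≡ n

Adjacent : {m : ℕ} → Vec ℕ m → Vec ℕ m → Set
Adjacent u v = diffCount u v ≡ 2

-- a clique in SR(m,n), given as a list of vertices which are pairwise adjacent
-- (adjacent vertices are in particular distinct, so the list has no repetitions)
IsClique : (m n : ℕ) → List (Vec ℕ m) → Set
IsClique m n C = All (IsVertex m n) C × AllPairs Adjacent C

LargestCliqueSize : (m n k : ℕ) → Set
LargestCliqueSize m n k =
  (∃ λ C → IsClique m n C × length C ≡ k) ×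
  (∀ C → IsClique m n C → length C ≤ k)

module Submission where

-- Lower bound: two explicit cliques.  The line (k, n-k, 0, …, 0), k = 0 … n, has n+1
-- vertices; the star (n, 0, …, 0) together with (n-1, eᵢ), i = 1 … m-1, has m.
--
-- Upper bound (clique-bound), by induction on the dimension m, looking at the first
-- coordinates ("heads") of the vertices of a clique C in SR(m+1, n):
--  * if the heads are pairwise distinct, they lie in {0, …, n}, so |C| ≤ n+1;
--  * otherwise two adjacent vertices c ∷ a, c ∷ b share a head c.
--    - If every vertex has head c, dropping it gives a clique of SR(m, n-c) and the
--      induction hypothesis applies.
--    - Otherwise pick q with head ≠ c.  The vertices with head c have tails at
--      distance one from tail q, so there are at most m of them (star-bound); and at
--      most one vertex has head ≠ c, because the tails of two such vertices are
--      common neighbours of a and b at distance one, which forces them to be equal or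
--      to have the sums that make the heads equal to c (common-neighbours).
--      Hence |C| ≤ m + 1.

open import Data.Nat using (ℕ; zero; suc; _+_; _∸_; _⊔_; _≤_; _<_; z≤n; s≤s; _≟_; _≤?_)
open import Data.Nat.Properties
open import Data.Vec using (Vec; []; _∷_; sum; head; tail; replicate)
open import Data.List using (List; []; _∷_; length; filter; map; applyDownFrom)
open import Data.List.Properties using (length-map; length-applyDownFrom)
open import Data.List.Relation.Unary.All as All using (All; []; _∷_)
import Data.List.Relation.Unary.All.Properties as AllP
open import Data.List.Relation.Unary.Any as Any using (here; there)
open import Data.List.Relation.Unary.AllPairs as AllPairs using (AllPairs; []; _∷_)
import Data.List.Relation.Unary.AllPairs.Properties as AllPairsP
open import Data.List.Membership.Propositional using (_∈_; find)
open import Data.List.Membership.Propositional.Properties using (∈-filter⁻)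
open import Data.Product using (_×_; _,_; ∃; ∃₂; proj₁; proj₂)
open import Data.Sum using (_⊎_; inj₁; inj₂)
open import Data.Empty using (⊥-elim)
open import Relation.Nullary using (¬_; yes; no)
open import Relation.Unary using (Pred; Decidable)
open import Relation.Unary.Properties using (∁?)
open import Relation.Binary using (Rel; tri<; tri≈; tri>)
import Relation.Binary as B
open import Relation.Binary.PropositionalEquality
open import Data.Nat.Solver using (module +-*-Solver)
open +-*-Solver using (solve; _:+_; _:=_)

open import Defs

diffCount-self : ∀ {m} (v : Vec ℕ m) → diffCount v v ≡ 0
diffCount-self [] = refl
diffCount-self (x ∷ v) with x ≟ x
... | yes _ = diffCount-self v
... | no x≢x = ⊥-elim (x≢x refl)

diffCount≡0⇒≡ : ∀ {m} {u v : Vec ℕ m} → diffCount u v ≡ 0 → u ≡ v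
diffCount≡0⇒≡ {u = []} {[]} _ = refl
diffCount≡0⇒≡ {u = x ∷ u} {y ∷ v} d with x ≟ y
diffCount≡0⇒≡ {u = x ∷ u} {y ∷ v} d | yes refl = cong (x ∷_) (diffCount≡0⇒≡ d)
diffCount≡0⇒≡ {u = x ∷ u} {y ∷ v} () | no _

diffCount-∷-≡ : ∀ {m} x (u v : Vec ℕ m) → diffCount (x ∷ u) (x ∷ v) ≡ diffCount u v
diffCount-∷-≡ x u v with x ≟ x
... | yes _ = refl
... | no x≢x = ⊥-elim (x≢x refl)

diffCount-∷-≢ : ∀ {m x y} (u v : Vec ℕ m) → x ≢ y → diffCount (x ∷ u) (y ∷ v) ≡ suc (diffCount u v)
diffCount-∷-≢ {x = x} {y} u v x≢y with x ≟ y
... | yes x≡y = ⊥-elim (x≢y x≡y)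
... | no _ = refl

diffCount-sym : ∀ {m} (u v : Vec ℕ m) → diffCount u v ≡ diffCount v u
diffCount-sym [] [] = refl
diffCount-sym (x ∷ u) (y ∷ v) with x ≟ y | y ≟ x
... | yes _ | yes _ = diffCount-sym u v
... | yes x≡y | no y≢x = ⊥-elim (y≢x (sym x≡y))
... | no x≢y | yes y≡x = ⊥-elim (x≢y (sym y≡x))
... | no _ | no _ = cong suc (diffCount-sym u v)

adjacent⇒≢ : ∀ {m} {u v : Vec ℕ m} → Adjacent u v → u ≢ v
adjacent⇒≢ {u = u} adj refl with trans (sym (diffCount-self u)) adj
... | ()

adjacent-sym : ∀ {m} (u v : Vec ℕ m) → Adjacent u v → Adjacent v u
adjacent-sym u v adj = trans (diffCount-sym v u) adj

adjacent-∷-≡ : ∀ {m} x (u v : Vec ℕ m) → Adjacent (x ∷ u) (x ∷ v) → Adjacent u v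
adjacent-∷-≡ x u v adj = trans (sym (diffCount-∷-≡ x u v)) adj

diffCount-drop-≢ : ∀ {m x y k} {u v : Vec ℕ m} → x ≢ y → diffCount (x ∷ u) (y ∷ v) ≡ suc k →
                   diffCount u v ≡ k
diffCount-drop-≢ {u = u} {v} x≢y d = suc-injective (trans (sym (diffCount-∷-≢ u v x≢y)) d)

adjacent-tails⇒≡-heads : ∀ {m x y} {u v : Vec ℕ m} → Adjacent (x ∷ u) (y ∷ v) → Adjacent u v → x ≡ y
adjacent-tails⇒≡-heads {x = x} {y} {u} {v} adj uv with x ≟ y
... | yes x≡y = x≡y
... | no _ with trans (cong suc (sym uv)) adj
...   | ()

module _ {a p} {A : Set a} {P : Pred A p} (P? : Decidable P) where

  length-filter-split : ∀ xs → length xs ≡ length (filter P? xs) + length (filter (∁? P?) xs)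
  length-filter-split [] = refl
  length-filter-split (x ∷ xs) with P? x
  ... | yes _ = cong suc (length-filter-split xs)
  ... | no _ = trans (cong suc (length-filter-split xs)) (sym (+-suc _ _))

  split-bound : ∀ {k l} xs → length (filter P? xs) ≤ k → length (filter (∁? P?) xs) ≤ l →
                length xs ≤ k + l
  split-bound xs bound₁ bound₂ =
    subst (_≤ _) (sym (length-filter-split xs)) (+-mono-≤ bound₁ bound₂)

  filter-members : ∀ xs → All (λ x → x ∈ xs × P x) (filter P? xs)
  filter-members xs = All.tabulate (∈-filter⁻ P?)

at-most-one : ∀ {a q r} {A : Set a} {Q : Pred A q} {R : Rel A r} →
              (∀ {x y} → Q x → Q y → ¬ R x y) → ∀ {xs} → All Q xs → AllPairs R xs → length xs ≤ 1
at-most-one never {[]} _ _ = z≤n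
at-most-one never {_ ∷ []} _ _ = s≤s z≤n
at-most-one never {_ ∷ _ ∷ _} (qx ∷ qy ∷ _) ((rxy ∷ _) ∷ _) = ⊥-elim (never qx qy rxy)

allPairs-refine : ∀ {a q r s} {A : Set a} {Q : Pred A q} {R : Rel A r} {S : Rel A s} →
                  (∀ {x y} → Q x → Q y → R x y → S x y) →
                  ∀ {xs} → All Q xs → AllPairs R xs → AllPairs S xs
allPairs-refine f [] [] = []
allPairs-refine f (qx ∷ qxs) (rx ∷ rxs) =
  All.zipWith (λ (qy , rxy) → f qx qy rxy) (qxs , rx) ∷ allPairs-refine f qxs rxs

pairwise-or-witness : ∀ {a r s} {A : Set a} {R : Rel A r} {S : Rel A s} → B.Decidable S →
                      ∀ {xs} → AllPairs R xs →
                      AllPairs (λ x y → ¬ S x y) xs ⊎ ∃₂ λ x y → x ∈ xs × y ∈ xs × R x y × S x y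
pairwise-or-witness S? {[]} [] = inj₁ []
pairwise-or-witness S? {x ∷ xs} (rx ∷ rxs) with pairwise-or-witness S? rxs
... | inj₂ (y , z , y∈ , z∈ , ryz , syz) = inj₂ (y , z , there y∈ , there z∈ , ryz , syz)
... | inj₁ none with Any.any? (S? x) xs
...   | yes some = let (y , y∈ , sxy) = find some in
                   inj₂ (x , y , here refl , there y∈ , All.lookup rx y∈ , sxy)
...   | no nothing = inj₁ (AllP.¬Any⇒All¬ xs nothing ∷ none)

distinct-below : ∀ k {xs : List ℕ} → All (_< k) xs → AllPairs _≢_ xs → length xs ≤ k
distinct-below zero {[]} _ _ = z≤n
distinct-below zero {_ ∷ _} (() ∷ _) _
distinct-below (suc k) {xs} below distinct = split-bound (_≟ k) xs equal-k below-k
  where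
  equal-k : length (filter (_≟ k) xs) ≤ 1
  equal-k = at-most-one (λ { refl refl k≢k → k≢k refl })
              (AllP.all-filter (_≟ k) xs) (AllPairsP.filter⁺ _ distinct)
  below-k : length (filter (∁? (_≟ k)) xs) ≤ k
  below-k = distinct-below k
              (All.zipWith (λ (x<1+k , x≢k) → ≤∧≢⇒< (≤-pred x<1+k) x≢k)
                (AllP.filter⁺ _ below , AllP.all-filter (∁? (_≟ k)) xs))
              (AllPairsP.filter⁺ _ distinct)

clique-adjacent : ∀ {m n} {C : List (Vec ℕ m)} {u v : Vec ℕ m} → IsClique m n C →
                  u ∈ C → v ∈ C → u ≢ v → Adjacent u v
clique-adjacent (_ ∷ _ , _ ∷ _) (here refl) (here refl) u≢v = ⊥-elim (u≢v refl)
clique-adjacent (_ , adj ∷ _) (here refl) (there v∈) _ = All.lookup adj v∈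
clique-adjacent {u = u} {v} (_ , adj ∷ _) (there u∈) (here refl) _ = adjacent-sym v u (All.lookup adj u∈)
clique-adjacent (_ ∷ vs , _ ∷ adjs) (there u∈) (there v∈) u≢v = clique-adjacent (vs , adjs) u∈ v∈ u≢v

filter-clique : ∀ {m n p} {P : Pred (Vec ℕ m) p} (P? : Decidable P) {C} →
                IsClique m n C → IsClique m n (filter P? C)
filter-clique P? (vertices , adj) = AllP.filter⁺ P? vertices , AllPairsP.filter⁺ P? adj

tails-clique : ∀ {m n c} {C : List (Vec ℕ (suc m))} → IsClique (suc m) n C → All (λ v → head v ≡ c) C →
               IsClique m (n ∸ c) (map tail C)
tails-clique {m} {n} {c} (vertices , adj) heads =
  AllP.map⁺ (All.zipWith (λ {v} → tail-sum {v}) (vertices , heads)) ,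
  AllPairsP.map⁺ (allPairs-refine (λ {u} {v} → tail-adjacent {u} {v}) heads adj)
  where
  tail-sum : ∀ {v : Vec ℕ (suc m)} → sum v ≡ n × head v ≡ c → sum (tail v) ≡ n ∸ c
  tail-sum {v₀ ∷ v} (refl , refl) = sym (m+n∸m≡n v₀ (sum v))
  tail-adjacent : ∀ {u v : Vec ℕ (suc m)} → head u ≡ c → head v ≡ c →
                  Adjacent u v → Adjacent (tail u) (tail v)
  tail-adjacent {_ ∷ u} {_ ∷ v} refl refl = adjacent-∷-≡ c u v

-- Star lemma: a clique whose vertices all differ from y in exactly one coordinate
-- has at most m vertices (at most one per coordinate).
star-bound : ∀ {m s} (y : Vec ℕ m) {R} → IsClique m s R →
             All (λ r → diffCount y r ≡ 1) R → length R ≤ m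
star-bound [] {[]} _ _ = z≤n
star-bound [] {[] ∷ _} _ (() ∷ _)
star-bound {suc m} {s} (y₀ ∷ y) {R} clique near =
  ≤-trans (split-bound P? R same-head other-head) (≤-reflexive (+-comm m 1))
  where
  P? : Decidable (λ (r : Vec ℕ (suc m)) → head r ≡ y₀)
  P? r = head r ≟ y₀
  near-tail : ∀ {r : Vec ℕ (suc m)} → diffCount (y₀ ∷ y) r ≡ 1 × head r ≡ y₀ →
              diffCount y (tail r) ≡ 1
  near-tail {_ ∷ r} (d , refl) = trans (sym (diffCount-∷-≡ y₀ y r)) d
  -- Vertices keeping the head y₀: their tails form a star around y, one dimension lower.
  same-head : length (filter P? R) ≤ m
  same-head = ≤-trans (≤-reflexive (sym (length-map tail (filter P? R))))
    (star-bound y (tails-clique (filter-clique P? clique) (AllP.all-filter P? R))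
      (AllP.map⁺ (All.zipWith (λ {r} → near-tail {r}) (AllP.filter⁺ P? near , AllP.all-filter P? R))))
  -- Vertices changing the head agree with y elsewhere, so the common sum s determines them.
  OffHead : Vec ℕ (suc m) → Set
  OffHead r = sum r ≡ s × diffCount (y₀ ∷ y) r ≡ 1 × head r ≢ y₀
  unique : ∀ {r r′ : Vec ℕ (suc m)} → OffHead r → OffHead r′ → ¬ Adjacent r r′
  unique {r₀ ∷ r} {r₀′ ∷ r′} (sr , dr , hr) (sr′ , dr′ , hr′) adj
    with diffCount≡0⇒≡ {u = y} {r} (diffCount-drop-≢ (≢-sym hr) dr)
       | diffCount≡0⇒≡ {u = y} {r′} (diffCount-drop-≢ (≢-sym hr′) dr′)
  ... | refl | refl = adjacent⇒≢ adj (cong (_∷ y) (+-cancelʳ-≡ (sum y) r₀ r₀′ (trans sr (sym sr′))))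
  other-head : length (filter (∁? P?) R) ≤ 1
  other-head = at-most-one (λ {r} {r′} → unique {r} {r′})
    (All.zip (AllP.filter⁺ _ (proj₁ clique) , All.zip (AllP.filter⁺ _ near , AllP.all-filter (∁? P?) R)))
    (AllPairsP.filter⁺ _ (proj₂ clique))

common-neighbour-∷-≡ : ∀ {m} a₀ x₀ (a b x : Vec ℕ m) → Adjacent a b →
                       diffCount (a₀ ∷ a) (x₀ ∷ x) ≡ 1 → diffCount (a₀ ∷ b) (x₀ ∷ x) ≡ 1 →
                       x₀ ≡ a₀ × diffCount a x ≡ 1 × diffCount b x ≡ 1
common-neighbour-∷-≡ a₀ x₀ a b x ab ax bx with a₀ ≟ x₀
... | yes refl = refl , ax , bx
... | no _ with diffCount≡0⇒≡ {u = a} {x} (suc-injective ax) | diffCount≡0⇒≡ {u = b} {x} (suc-injective bx)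
...   | refl | refl = ⊥-elim (adjacent⇒≢ {u = x} ab refl)

common-neighbour-∷-≢ : ∀ {m} a₀ b₀ x₀ (a b x : Vec ℕ m) → a₀ ≢ b₀ → diffCount a b ≡ 1 →
                       diffCount (a₀ ∷ a) (x₀ ∷ x) ≡ 1 → diffCount (b₀ ∷ b) (x₀ ∷ x) ≡ 1 →
                       (x₀ ≡ a₀ × x ≡ b) ⊎ (x₀ ≡ b₀ × x ≡ a)
common-neighbour-∷-≢ a₀ b₀ x₀ a b x a₀≢b₀ ab ax bx with a₀ ≟ x₀ | b₀ ≟ x₀
... | yes refl | yes refl = ⊥-elim (a₀≢b₀ refl)
... | yes refl | no _ = inj₁ (refl , sym (diffCount≡0⇒≡ (suc-injective bx)))
... | no _ | yes refl = inj₂ (refl , sym (diffCount≡0⇒≡ (suc-injective ax)))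
... | no _ | no _ with diffCount≡0⇒≡ {u = a} {x} (suc-injective ax)
                  | diffCount≡0⇒≡ {u = b} {x} (suc-injective bx)
...   | refl | refl with trans (sym (diffCount-self a)) ab
...     | ()

-- Common neighbours: if a and b are adjacent, a vector at distance one from both takes
-- the value of a at one of their two differing coordinates and that of b at the other.
common-neighbours : ∀ {m} (a b x y : Vec ℕ m) → Adjacent a b →
                    diffCount a x ≡ 1 → diffCount b x ≡ 1 → diffCount a y ≡ 1 → diffCount b y ≡ 1 →
                    x ≡ y ⊎ (Adjacent x y × sum x + sum y ≡ sum a + sum b)
common-neighbours [] [] [] [] () _ _ _ _
common-neighbours (a₀ ∷ a) (b₀ ∷ b) (x₀ ∷ x) (y₀ ∷ y) ab ax bx ay by with a₀ ≟ b₀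
... | yes refl with common-neighbour-∷-≡ a₀ x₀ a b x ab ax bx
                 | common-neighbour-∷-≡ a₀ y₀ a b y ab ay by
...   | refl , ax′ , bx′ | refl , ay′ , by′ with common-neighbours a b x y ab ax′ bx′ ay′ by′
...     | inj₁ refl = inj₁ refl
...     | inj₂ (xy , sums) = inj₂ (trans (diffCount-∷-≡ a₀ x y) xy ,
            trans (interchange a₀ (sum x) a₀ (sum y))
              (trans (cong (a₀ + a₀ +_) sums) (sym (interchange a₀ (sum a) a₀ (sum b)))))
  where
  interchange : ∀ p q r s → p + q + (r + s) ≡ p + r + (q + s)
  interchange = solve 4 (λ p q r s → p :+ q :+ (r :+ s) := p :+ r :+ (q :+ s)) refl
common-neighbours (a₀ ∷ a) (b₀ ∷ b) (x₀ ∷ x) (y₀ ∷ y) ab ax bx ay by | no a₀≢b₀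
  with common-neighbour-∷-≢ a₀ b₀ x₀ a b x a₀≢b₀ (suc-injective ab) ax bx
     | common-neighbour-∷-≢ a₀ b₀ y₀ a b y a₀≢b₀ (suc-injective ab) ay by
... | inj₁ (refl , refl) | inj₁ (refl , refl) = inj₁ refl
... | inj₂ (refl , refl) | inj₂ (refl , refl) = inj₁ refl
... | inj₁ (refl , refl) | inj₂ (refl , refl) =
      inj₂ (trans (diffCount-∷-≢ b a a₀≢b₀) (cong suc (trans (diffCount-sym b a) (suc-injective ab))) ,
            swap-tails a₀ (sum b) b₀ (sum a))
  where
  swap-tails : ∀ p q r s → p + q + (r + s) ≡ p + s + (r + q)
  swap-tails = solve 4 (λ p q r s → p :+ q :+ (r :+ s) := p :+ s :+ (r :+ q)) refl
... | inj₂ (refl , refl) | inj₁ (refl , refl) =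
      inj₂ (trans (diffCount-∷-≢ a b (≢-sym a₀≢b₀)) (cong suc (suc-injective ab)) ,
            swap-heads a₀ (sum a) b₀ (sum b))
  where
  swap-heads : ∀ p q r s → r + q + (p + s) ≡ p + q + (r + s)
  swap-heads = solve 4 (λ p q r s → r :+ q :+ (p :+ s) := p :+ q :+ (r :+ s)) refl

double-injective : ∀ p q → p + p ≡ q + q → p ≡ q
double-injective p q e with <-cmp p q
... | tri≈ _ p≡q _ = p≡q
... | tri< p<q _ _ = ⊥-elim (<-irrefl e (+-mono-< p<q p<q))
... | tri> _ _ p>q = ⊥-elim (<-irrefl (sym e) (+-mono-< p>q p>q))

off-column-nonadjacent : ∀ {m n c x₀ y₀} {a b xs ys : Vec ℕ m} →
  c + sum a ≡ n → c + sum b ≡ n → x₀ + sum xs ≡ n → y₀ + sum ys ≡ n → x₀ ≢ c → Adjacent a b →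
  diffCount a xs ≡ 1 → diffCount b xs ≡ 1 → diffCount a ys ≡ 1 → diffCount b ys ≡ 1 →
  ¬ Adjacent (x₀ ∷ xs) (y₀ ∷ ys)
off-column-nonadjacent {c = c} {x₀} {y₀} {a} {b} {xs} {ys} sa sb sx sy x₀≢c ab axs bxs ays bys adj
  with common-neighbours a b xs ys ab axs bxs ays bys
... | inj₁ refl =
      adjacent⇒≢ {u = x₀ ∷ xs} adj (cong (_∷ xs) (+-cancelʳ-≡ (sum xs) x₀ y₀ (trans sx (sym sy))))
... | inj₂ (xsys , sums) with adjacent-tails⇒≡-heads {x = x₀} {y₀} {xs} {ys} adj xsys
off-column-nonadjacent {c = c} {x₀} {.x₀} {a} {b} {xs} {ys} sa sb sx sy x₀≢c ab axs bxs ays bys adj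
  | inj₂ (xsys , sums) | refl = x₀≢c (+-cancelʳ-≡ (sum a) x₀ c (begin
    x₀ + sum a   ≡⟨ cong (x₀ +_) (sym sum-xs≡sum-a) ⟩
    x₀ + sum xs  ≡⟨ trans sx (sym sa) ⟩
    c + sum a    ∎))
  where
  open ≡-Reasoning
  sum-xs≡sum-a : sum xs ≡ sum a
  sum-xs≡sum-a = double-injective (sum xs) (sum a) (begin
    sum xs + sum xs  ≡⟨ cong (sum xs +_) (+-cancelˡ-≡ x₀ (sum xs) (sum ys) (trans sx (sym sy))) ⟩
    sum xs + sum ys  ≡⟨ sums ⟩
    sum a + sum b    ≡⟨ cong (sum a +_) (+-cancelˡ-≡ c (sum b) (sum a) (trans sb (sym sa))) ⟩
    sum a + sum a    ∎)

distinct-heads-bound : ∀ {m n} {C : List (Vec ℕ (suc m))} → All (IsVertex (suc m) n) C →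
                       AllPairs (λ u v → head u ≢ head v) C → length C ≤ suc n
distinct-heads-bound {m} {n} {C} vertices distinct =
  subst (_≤ suc n) (length-map head C)
    (distinct-below (suc n) (AllP.map⁺ (All.map (λ {v} → head-bound {v}) vertices)) (AllPairsP.map⁺ distinct))
  where
  head-bound : ∀ {v : Vec ℕ (suc m)} → sum v ≡ n → head v < suc n
  head-bound {v₀ ∷ v} refl = s≤s (m≤m+n v₀ (sum v))

-- A clique containing two adjacent vertices c ∷ a, c ∷ b and a vertex q with a head
-- other than c has at most m+1 vertices: at most m with head c, which form a star
-- around tail q, and at most one other.
mixed-column-bound : ∀ {m n c} {C : List (Vec ℕ (suc m))} {a b q} → IsClique (suc m) n C →
                     (c ∷ a) ∈ C → (c ∷ b) ∈ C → Adjacent a b →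
                     q ∈ C → head q ≢ c → length C ≤ suc m
mixed-column-bound {m} {n} {c} {C} {a} {b} {q} clique a∈ b∈ ab q∈ q≢c =
  ≤-trans (split-bound P? C on-column off-column) (≤-reflexive (+-comm m 1))
  where
  P? : Decidable (λ (v : Vec ℕ (suc m)) → head v ≡ c)
  P? v = head v ≟ c
  vertex : ∀ {v} → v ∈ C → sum v ≡ n
  vertex = All.lookup (proj₁ clique)
  tails-near : ∀ {u v} → u ∈ C → v ∈ C → head u ≢ head v → diffCount (tail u) (tail v) ≡ 1
  tails-near {_ ∷ u} {_ ∷ v} u∈ v∈ u₀≢v₀ =
    diffCount-drop-≢ {u = u} {v} u₀≢v₀ (clique-adjacent clique u∈ v∈ (λ { refl → u₀≢v₀ refl }))
  on-column : length (filter P? C) ≤ m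
  on-column = ≤-trans (≤-reflexive (sym (length-map tail (filter P? C))))
    (star-bound (tail q) (tails-clique (filter-clique P? clique) (AllP.all-filter P? C))
      (AllP.map⁺ (All.map (λ { {v} (v∈ , refl) → tails-near {q} {v} q∈ v∈ q≢c }) (filter-members P? C))))
  nonadjacent : ∀ {x y} → x ∈ C × head x ≢ c → y ∈ C × head y ≢ c → ¬ Adjacent x y
  nonadjacent {x₀ ∷ xs} {y₀ ∷ ys} (x∈ , x₀≢c) (y∈ , y₀≢c) =
    off-column-nonadjacent {a = a} {b} (vertex a∈) (vertex b∈) (vertex x∈) (vertex y∈) x₀≢c ab
      (tails-near a∈ x∈ (≢-sym x₀≢c)) (tails-near b∈ x∈ (≢-sym x₀≢c))
      (tails-near a∈ y∈ (≢-sym y₀≢c)) (tails-near b∈ y∈ (≢-sym y₀≢c))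
  off-column : length (filter (∁? P?) C) ≤ 1
  off-column = at-most-one (λ {x} {y} → nonadjacent {x} {y})
    (filter-members (∁? P?) C) (AllPairsP.filter⁺ _ (proj₂ clique))

clique-bound : ∀ m n (C : List (Vec ℕ m)) → IsClique m n C → length C ≤ m ⊔ suc n
clique-bound zero n C (vertices , adj) =
  ≤-trans (at-most-one (λ { {[]} {[]} _ _ () }) vertices adj) (s≤s z≤n)
clique-bound (suc m) n C clique with pairwise-or-witness (λ u v → head u ≟ head v) (proj₂ clique)
... | inj₁ distinct = ≤-trans (distinct-heads-bound (proj₁ clique) distinct) (m≤n⊔m (suc m) (suc n))
... | inj₂ (c ∷ a , .c ∷ b , a∈ , b∈ , adj , refl) with All.all? (λ v → head v ≟ c) C
...   | yes column = ≤-trans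
        (subst (_≤ _) (length-map tail C) (clique-bound m (n ∸ c) (map tail C) (tails-clique clique column)))
        (⊔-mono-≤ (n≤1+n m) (s≤s (m∸n≤m n c)))
...   | no off-column = let (q , q∈ , q≢c) = find (AllP.¬All⇒Any¬ (λ v → head v ≟ c) C off-column) in
        ≤-trans (mixed-column-bound clique a∈ b∈ (adjacent-∷-≡ c a b adj) q∈ q≢c)
                (m≤m⊔n (suc m) (suc n))

zeros : ∀ k → Vec ℕ k
zeros k = replicate k 0

sum-zeros : ∀ k → sum (zeros k) ≡ 0
sum-zeros zero = refl
sum-zeros (suc k) = sum-zeros k

units : ∀ k → List (Vec ℕ k)
units zero = []
units (suc k) = (1 ∷ zeros k) ∷ map (0 ∷_) (units k)

length-units : ∀ k → length (units k) ≡ k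
length-units zero = refl
length-units (suc k) = cong suc (trans (length-map (0 ∷_) (units k)) (length-units k))

units-sum : ∀ k → All (λ e → sum e ≡ 1) (units k)
units-sum zero = []
units-sum (suc k) = cong suc (sum-zeros k) ∷ AllP.map⁺ (units-sum k)

units-near-zeros : ∀ k → All (λ e → diffCount (zeros k) e ≡ 1) (units k)
units-near-zeros zero = []
units-near-zeros (suc k) =
  trans (diffCount-∷-≢ {x = 0} {1} (zeros k) (zeros k) (λ ())) (cong suc (diffCount-self (zeros k))) ∷
  AllP.map⁺ (All.map (λ {e} d → trans (diffCount-∷-≡ 0 (zeros k) e) d) (units-near-zeros k))

units-pairwise : ∀ k → AllPairs Adjacent (units k)
units-pairwise zero = []
units-pairwise (suc k) =
  AllP.map⁺ (All.map (λ {e} d → trans (diffCount-∷-≢ {x = 1} {0} (zeros k) e (λ ())) (cong suc d))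
                     (units-near-zeros k)) ∷
  AllPairsP.map⁺ (AllPairs.map (λ {e} {e′} d → trans (diffCount-∷-≡ 0 e e′) d) (units-pairwise k))

star-clique : ∀ m n → List (Vec ℕ (suc m))
star-clique m n = (suc n ∷ zeros m) ∷ map (n ∷_) (units m)

length-star-clique : ∀ m n → length (star-clique m n) ≡ suc m
length-star-clique m n = cong suc (trans (length-map (n ∷_) (units m)) (length-units m))

star-clique-isClique : ∀ m n → IsClique (suc m) (suc n) (star-clique m n)
star-clique-isClique m n =
  (cong suc (trans (cong (n +_) (sum-zeros m)) (+-identityʳ n)) ∷
   AllP.map⁺ (All.map (λ {e} s → trans (cong (n +_) s) (+-comm n 1)) (units-sum m))) ,
  (AllP.map⁺ (All.map (λ {e} d → trans (diffCount-∷-≢ {x = suc n} {n} (zeros m) e 1+n≢n) (cong suc d))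
                      (units-near-zeros m)) ∷
   AllPairsP.map⁺ (AllPairs.map (λ {e} {e′} d → trans (diffCount-∷-≡ n e e′) d) (units-pairwise m)))

line-vertex : ∀ m n → ℕ → Vec ℕ (suc (suc m))
line-vertex m n k = k ∷ (n ∸ k) ∷ zeros m

line-clique : ∀ m n → List (Vec ℕ (suc (suc m)))
line-clique m n = applyDownFrom (line-vertex m n) (suc n)

length-line-clique : ∀ m n → length (line-clique m n) ≡ suc n
length-line-clique m n = length-applyDownFrom (line-vertex m n) (suc n)

line-clique-isClique : ∀ m n → IsClique (suc (suc m)) n (line-clique m n)
line-clique-isClique m n =
  AllP.applyDownFrom⁺₁ (line-vertex m n) (suc n) vertex ,
  AllPairsP.applyDownFrom⁺₁ (line-vertex m n) (suc n) adjacent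
  where
  vertex : ∀ {k} → k < suc n → sum (line-vertex m n k) ≡ n
  vertex {k} k<1+n = begin
    k + (n ∸ k + sum (zeros m))  ≡⟨ cong (λ s → k + (n ∸ k + s)) (sum-zeros m) ⟩
    k + (n ∸ k + 0)              ≡⟨ cong (k +_) (+-identityʳ (n ∸ k)) ⟩
    k + (n ∸ k)                  ≡⟨ m+[n∸m]≡n (≤-pred k<1+n) ⟩
    n                            ∎
    where open ≡-Reasoning
  adjacent : ∀ {i j} → j < i → i < suc n → Adjacent (line-vertex m n i) (line-vertex m n j)
  adjacent {i} {j} j<i i<1+n =
    trans (diffCount-∷-≢ _ _ (≢-sym (<⇒≢ j<i)))
      (cong suc (trans (diffCount-∷-≢ _ _ (<⇒≢ (∸-monoʳ-< j<i (≤-pred i<1+n))))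
                  (cong suc (diffCount-self (zeros m)))))

mainTheorem9 : (m n : ℕ) → 1 < m → 0 < n → LargestCliqueSize m n (m ⊔ suc n)
mainTheorem9 zero _ () _
mainTheorem9 (suc zero) _ (s≤s ()) _
mainTheorem9 (suc (suc m)) zero _ ()
mainTheorem9 (suc (suc m)) (suc n) _ _ = largest-clique , clique-bound (suc (suc m)) (suc n)
  where
  largest-clique : ∃ λ C → IsClique (suc (suc m)) (suc n) C × length C ≡ suc (suc m) ⊔ suc (suc n)
  largest-clique with suc (suc m) ≤? suc (suc n)
  ... | yes m≤n+1 = line-clique m (suc n) , line-clique-isClique m (suc n) ,
                    trans (length-line-clique m (suc n)) (sym (m≤n⇒m⊔n≡n m≤n+1))
  ... | no m≰n+1 = star-clique (suc m) n , star-clique-isClique (suc m) n ,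
                   trans (length-star-clique (suc m) n) (sym (m≥n⇒m⊔n≡m (≰⇒≥ m≰n+1)))
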